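{- Let $d\ge 1$ be an integer and let $G$ be a graph without isolated vertices. Let $H$ be the graph obtained from $G$ by adding, for each edge $e=\{u,v\}$ of $G$, a new vertex $x_e$ adjacent exactly to $u$ and $v$ (so $H$ is the primal graph of the CNF $\psi(G)$). Then $d\text{ - }pw(G) \leq d\text{ - }pw(H) \leq d\text{ - }pw(G)+1$.
   Context: For an integer $d\ge1$ and a graph $G$, the $d$-pathwidth $d\text{ - }pw(G)$ is the smallest $k$ such that there are subgraphs $G_1,\dots,G_d$ of $G$, each of pathwidth at most $k$, with $G=G_1\cup\dots\cup G_d$. For a graph $G$ without isolated vertices, $\psi(G)$ is the CNF with variable set $V(G)\cup E(G)$ and, for each edge $e=\{u,v\}$, the clause $(u\vee e\vee v)$. -}

module Defs where

open import Data.Nat using (ℕ; zero; suc; _+_; _≤_)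
open import Data.Fin as Fin using (Fin; toℕ; _↑ˡ_; _↑ʳ_; splitAt)
open import Data.Fin.Subset using (Subset; _∈_; ∣_∣)
open import Data.Sum using (_⊎_; inj₁; inj₂)
open import Data.Product using (Σ; ∃; ∃-syntax; _×_; _,_)
open import Relation.Binary.PropositionalEquality using (_≡_; _≢_)

record Graph : Set where
  field
    n   : ℕ
    m   : ℕ
    src : Fin m → Fin n
    tgt : Fin m → Fin n
open Graph public

Simple : Graph → Set
Simple G =
  (∀ e → src G e ≢ tgt G e) ×
  (∀ e f → ((src G e ≡ src G f × tgt G e ≡ tgt G f) ⊎
            (src G e ≡ tgt G f × tgt G e ≡ src G f)) → e ≡ f)

Incident : (G : Graph) → Fin (n G) → Fin (m G) → Set
Incident G v e = (v ≡ src G e) ⊎ (v ≡ tgt G e)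

NoIsolatedVertices : Graph → Set
NoIsolatedVertices G = ∀ v → ∃[ e ] Incident G v e

record Subgraph (G : Graph) : Set where
  field
    vs     : Subset (n G)
    es     : Subset (m G)
    closed : ∀ e → e ∈ es → (src G e ∈ vs) × (tgt G e ∈ vs)
open Subgraph public

record PathDecomp {G : Graph} (S : Subgraph G) (k : ℕ) : Set where
  field
    r       : ℕ
    bag     : Fin r → Subset (n G)
    bag⊆    : ∀ i v → v ∈ bag i → v ∈ vs S
    vcover  : ∀ v → v ∈ vs S → ∃[ i ] (v ∈ bag i)
    ecover  : ∀ e → e ∈ es S → ∃[ i ] ((src G e ∈ bag i) × (tgt G e ∈ bag i))
    contig  : ∀ v (i j l : Fin r) → toℕ i ≤ toℕ j → toℕ j ≤ toℕ l →
              v ∈ bag i → v ∈ bag l → v ∈ bag j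
    width   : ∀ i → ∣ bag i ∣ ≤ suc k

PW≤ : {G : Graph} → Subgraph G → ℕ → Set
PW≤ S k = PathDecomp S k

DPW≤ : ℕ → Graph → ℕ → Set
DPW≤ d G k =
  Σ (Fin d → Subgraph G) λ Gs →
    (∀ i → PW≤ (Gs i) k) ×
    (∀ v → ∃[ i ] (v ∈ vs (Gs i))) ×
    (∀ e → ∃[ i ] (e ∈ es (Gs i)))

IsDPW : ℕ → Graph → ℕ → Set
IsDPW d G w = DPW≤ d G w × (∀ k → DPW≤ d G k → w ≤ k)

-- H: add for each edge e = {u,v} a new vertex x_e adjacent exactly to u and v.
-- Vertices: Fin (n + m), x_e = n ↑ʳ e.
-- Edges: Fin (m + (m + m)): original edges, then {u,x_e}, then {v,x_e}.
primalH : Graph → Graph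
primalH G = record
  { n   = n G + m G
  ; m   = m G + (m G + m G)
  ; src = s
  ; tgt = t
  }
  where
  s : Fin (m G + (m G + m G)) → Fin (n G + m G)
  s a with splitAt (m G) a
  ... | inj₁ e = src G e ↑ˡ m G
  ... | inj₂ b with splitAt (m G) b
  ...   | inj₁ e = src G e ↑ˡ m G
  ...   | inj₂ e = tgt G e ↑ˡ m G
  t : Fin (m G + (m G + m G)) → Fin (n G + m G)
  t a with splitAt (m G) a
  ... | inj₁ e = tgt G e ↑ˡ m G
  ... | inj₂ b with splitAt (m G) b
  ...   | inj₁ e = n G ↑ʳ e
  ...   | inj₂ e = n G ↑ʳ e

-- Deleting the new vertices x_e turns a cover of H by d subgraphs of pathwidth ≤ k
-- into such a cover of G, so d-pw(G) ≤ d-pw(H). Conversely, take a cover of G and put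
-- each x_e, with its two edges, into a subgraph G_i that contains e. In a path
-- decomposition of G_i pick a bag containing both ends of e and insert right after it
-- a copy of that bag with x_e added. Every new bag exceeds an old one by at most one
-- vertex and x_e lies in a single bag, so d-pw(H) ≤ d-pw(G) + 1.
module Submission where

open import Defs
open import Data.Nat using (ℕ; suc; _+_; _*_; _≤_; z≤n)
open import Data.Nat.Properties using (≤-refl; ≤-trans; m≤m+n; +-mono-≤; +-comm; ≮⇒≥; <⇒≱; module ≤-Reasoning)
open import Data.Product using (_×_; ∃-syntax; _,_; proj₁; proj₂)
open import Data.Sum using (inj₁; inj₂)
open import Data.Bool using (Bool; true; false)
open import Data.Maybe using (Maybe; just; nothing)
open import Data.Maybe.Properties using (just-injective; ≡-dec)
open import Data.Empty using (⊥-elim)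
open import Data.Fin as Fin using (Fin; toℕ; _↑ˡ_; _↑ʳ_; splitAt; combine; remQuot)
open import Data.Fin.Properties
  using (splitAt⁻¹-↑ˡ; splitAt⁻¹-↑ʳ; splitAt-↑ˡ; splitAt-↑ʳ; remQuot-combine; combine-remQuot; combine-monoˡ-<)
import Data.Fin.Properties as Fin
open import Data.Fin.Subset using (Subset; _∈_; ∣_∣; ⁅_⁆) renaming (⊥ to ∅)
open import Data.Fin.Subset.Properties using (∉⊥; ∣⊥∣≡0; ∣⁅x⁆∣≡1; x∈⁅x⁆; x∈⁅y⁆⇒x≡y)
open import Data.Vec using (_∷_; []; _++_; take; drop; tabulate; here; there)
open import Data.Vec.Properties using (take++drop≡id; lookup∘tabulate; lookup⇒[]=; []=⇒lookup)
open import Function using (_∘_)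
open import Relation.Nullary using (yes; no; does; contradiction)
open import Relation.Nullary.Decidable using (dec-true)
open import Relation.Binary.Definitions using (DecidableEquality)
open import Relation.Binary.PropositionalEquality

∈-++⁺ˡ : ∀ {n m} {x : Fin n} (p : Subset n) (q : Subset m) → x ∈ p → x ↑ˡ m ∈ p ++ q
∈-++⁺ˡ (_ ∷ p) q here      = here
∈-++⁺ˡ (_ ∷ p) q (there h) = there (∈-++⁺ˡ p q h)

∈-++⁻ˡ : ∀ {n m} {x : Fin n} (p : Subset n) (q : Subset m) → x ↑ˡ m ∈ p ++ q → x ∈ p
∈-++⁻ˡ {x = Fin.zero}  (_ ∷ p) q here      = here
∈-++⁻ˡ {x = Fin.suc x} (_ ∷ p) q (there h) = there (∈-++⁻ˡ p q h)

∈-++⁺ʳ : ∀ {n m} {x : Fin m} (p : Subset n) (q : Subset m) → x ∈ q → n ↑ʳ x ∈ p ++ q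
∈-++⁺ʳ []      q h = h
∈-++⁺ʳ (_ ∷ p) q h = there (∈-++⁺ʳ p q h)

∈-++⁻ʳ : ∀ {n m} {x : Fin m} (p : Subset n) (q : Subset m) → n ↑ʳ x ∈ p ++ q → x ∈ q
∈-++⁻ʳ []      q h         = h
∈-++⁻ʳ (_ ∷ p) q (there h) = ∈-++⁻ʳ p q h

∣p++q∣≡∣p∣+∣q∣ : ∀ {n m} (p : Subset n) (q : Subset m) → ∣ p ++ q ∣ ≡ ∣ p ∣ + ∣ q ∣
∣p++q∣≡∣p∣+∣q∣ []          q = refl
∣p++q∣≡∣p∣+∣q∣ (true ∷ p)  q = cong suc (∣p++q∣≡∣p∣+∣q∣ p q)
∣p++q∣≡∣p∣+∣q∣ (false ∷ p) q = ∣p++q∣≡∣p∣+∣q∣ p q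

∈-take⁺ : ∀ {n m} {x : Fin n} (p : Subset (n + m)) → x ↑ˡ m ∈ p → x ∈ take n p
∈-take⁺ {n} p h = ∈-++⁻ˡ (take n p) (drop n p) (subst (_ ∈_) (sym (take++drop≡id n p)) h)

∈-take⁻ : ∀ {n m} {x : Fin n} (p : Subset (n + m)) → x ∈ take n p → x ↑ˡ m ∈ p
∈-take⁻ {n} p h = subst (_ ∈_) (take++drop≡id n p) (∈-++⁺ˡ (take n p) (drop n p) h)

∣take∣≤∣p∣ : ∀ {n m} (p : Subset (n + m)) → ∣ take n p ∣ ≤ ∣ p ∣
∣take∣≤∣p∣ {n} p = begin
  ∣ take n p ∣                  ≤⟨ m≤m+n _ _ ⟩
  ∣ take n p ∣ + ∣ drop n p ∣   ≡⟨ ∣p++q∣≡∣p∣+∣q∣ (take n p) (drop n p) ⟨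
  ∣ take n p ++ drop n p ∣      ≡⟨ cong ∣_∣ (take++drop≡id n p) ⟩
  ∣ p ∣                         ∎
  where open ≤-Reasoning

∈-tabulate⁺ : ∀ {m} (f : Fin m → Bool) {x : Fin m} → f x ≡ true → x ∈ tabulate f
∈-tabulate⁺ f {x} fx = lookup⇒[]= x (tabulate f) (trans (lookup∘tabulate f x) fx)

∈-tabulate⁻ : ∀ {m} (f : Fin m → Bool) {x : Fin m} → x ∈ tabulate f → f x ≡ true
∈-tabulate⁻ f {x} h = trans (sym (lookup∘tabulate f x)) ([]=⇒lookup h)

quotient-mono : ∀ {r} k {a b : Fin (r * k)} → a Fin.≤ b →
                proj₁ (remQuot {r} k a) Fin.≤ proj₁ (remQuot {r} k b)
quotient-mono {r} k {a} {b} a≤b = ≮⇒≥ λ qb<qa →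
  <⇒≱ (subst₂ Fin._<_ (combine-remQuot {r} k b) (combine-remQuot {r} k a)
                       (combine-monoˡ-< (proj₂ (remQuot {r} k b)) (proj₂ (remQuot {r} k a)) qb<qa))
      a≤b

Contiguous : ∀ {r n} → (Fin r → Subset n) → Set
Contiguous {r} bag =
  ∀ v (i j l : Fin r) → toℕ i ≤ toℕ j → toℕ j ≤ toℕ l → v ∈ bag i → v ∈ bag l → v ∈ bag j

take-contiguous : ∀ {r n m} (bag : Fin r → Subset (n + m)) →
                  Contiguous bag → Contiguous (take n ∘ bag)
take-contiguous bag contig v i j l i≤j j≤l hi hl =
  ∈-take⁺ (bag j) (contig (v ↑ˡ _) i j l i≤j j≤l (∈-take⁻ (bag i) hi) (∈-take⁻ (bag l) hl))

data SplitView (n m : ℕ) : Fin (n + m) → Set where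
  left  : (v : Fin n) → SplitView n m (v ↑ˡ m)
  right : (e : Fin m) → SplitView n m (n ↑ʳ e)

splitView : ∀ n m (w : Fin (n + m)) → SplitView n m w
splitView n m w with splitAt n w in eq
... | inj₁ v = subst (SplitView n m) (splitAt⁻¹-↑ˡ eq) (left v)
... | inj₂ e = subst (SplitView n m) (splitAt⁻¹-↑ʳ eq) (right e)

-- The bags of a sequence B_0, …, B_{r-1} on n vertices, enlarged by m new vertices, the
-- new vertex e being pinned to the bag slot e (if any). The new bags are indexed by pairs
-- (j , c) in lexicographic order: (j , 0) is B_j, and (j , 1 + e) is B_j together with
-- e when e is pinned to j, and B_j otherwise.
module Refinement {n m r : ℕ} (B : Fin r → Subset n) (slot : Fin m → Maybe (Fin r)) where

  _≟_ : DecidableEquality (Maybe (Fin r))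
  _≟_ = ≡-dec Fin._≟_

  pinned : Fin r → Fin (suc m) → Subset m
  pinned j Fin.zero = ∅
  pinned j (Fin.suc e) with slot e ≟ just j
  ... | yes _ = ⁅ e ⁆
  ... | no _  = ∅

  ∣pinned∣≤1 : ∀ j c → ∣ pinned j c ∣ ≤ 1
  ∣pinned∣≤1 j Fin.zero = subst (_≤ 1) (sym (∣⊥∣≡0 m)) z≤n
  ∣pinned∣≤1 j (Fin.suc e) with slot e ≟ just j
  ... | yes _ = subst (_≤ 1) (sym (∣⁅x⁆∣≡1 e)) ≤-refl
  ... | no _  = subst (_≤ 1) (sym (∣⊥∣≡0 m)) z≤n

  ∈-pinned⁺ : ∀ {j e} → slot e ≡ just j → e ∈ pinned j (Fin.suc e)
  ∈-pinned⁺ {j} {e} s with slot e ≟ just j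
  ... | yes _ = x∈⁅x⁆ e
  ... | no ¬s = contradiction s ¬s

  ∈-pinned⁻ : ∀ {j c e} → e ∈ pinned j c → c ≡ Fin.suc e × slot e ≡ just j
  ∈-pinned⁻ {j} {Fin.zero} h = ⊥-elim (∉⊥ h)
  ∈-pinned⁻ {j} {Fin.suc e'} h with slot e' ≟ just j
  ... | yes s with refl ← x∈⁅y⁆⇒x≡y e' h = refl , s
  ... | no _  = ⊥-elim (∉⊥ h)

  bagAt : Fin r × Fin (suc m) → Subset (n + m)
  bagAt (j , c) = B j ++ pinned j c

  refined : Fin (r * suc m) → Subset (n + m)
  refined a = bagAt (remQuot (suc m) a)

  quotient : Fin (r * suc m) → Fin r
  quotient a = proj₁ (remQuot {r} (suc m) a)

  refined-combine : ∀ j c → refined (combine j c) ≡ bagAt (j , c)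
  refined-combine j c = cong bagAt (remQuot-combine j c)

  old∈refined⁺ : ∀ {v j} c → v ∈ B j → v ↑ˡ m ∈ refined (combine j c)
  old∈refined⁺ {j = j} c h = subst (_ ∈_) (sym (refined-combine j c)) (∈-++⁺ˡ (B j) (pinned j c) h)

  old∈refined⁻ : ∀ {v} a → v ↑ˡ m ∈ refined a → v ∈ B (quotient a)
  old∈refined⁻ a h = ∈-++⁻ˡ (B (quotient a)) _ h

  new∈refined⁺ : ∀ {e j} → slot e ≡ just j → n ↑ʳ e ∈ refined (combine j (Fin.suc e))
  new∈refined⁺ {e} {j} s =
    subst (_ ∈_) (sym (refined-combine j (Fin.suc e))) (∈-++⁺ʳ (B j) _ (∈-pinned⁺ s))

  new∈refined⁻ : ∀ {e} a → n ↑ʳ e ∈ refined a →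
                 ∃[ j ] (slot e ≡ just j × a ≡ combine j (Fin.suc e))
  new∈refined⁻ {e} a h with c≡ , s ← ∈-pinned⁻ (∈-++⁻ʳ (B (quotient a)) _ h) =
    quotient a , s , trans (sym (combine-remQuot {r} (suc m) a)) (cong (combine (quotient a)) c≡)

  -- A new vertex lies in a single refined bag, so only the old vertices need B's contiguity.
  refined-contiguous : Contiguous B → Contiguous refined
  refined-contiguous contig w a b c a≤b b≤c ha hc with splitView n m w
  refined-contiguous contig .(v ↑ˡ m) a b c a≤b b≤c ha hc | left v =
    ∈-++⁺ˡ (B (quotient b)) _
      (contig v (quotient a) (quotient b) (quotient c)
              (quotient-mono (suc m) a≤b) (quotient-mono (suc m) b≤c)
              (old∈refined⁻ a ha) (old∈refined⁻ c hc))
  refined-contiguous contig .(n ↑ʳ e) a b c a≤b b≤c ha hc | right e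
    with ja , sa , a≡ ← new∈refined⁻ a ha | jc , sc , c≡ ← new∈refined⁻ c hc = subst (λ x → _ ∈ refined x) a≡b ha
    where
    a≡c : a ≡ c
    a≡c = trans a≡ (trans (cong (λ j → combine j (Fin.suc e)) (just-injective (trans (sym sa) sc))) (sym c≡))
    a≡b : a ≡ b
    a≡b = Fin.≤-antisym a≤b (subst (b Fin.≤_) (sym a≡c) b≤c)

  refined-width : ∀ {k} → (∀ j → ∣ B j ∣ ≤ suc k) → ∀ a → ∣ refined a ∣ ≤ suc (suc k)
  refined-width {k} width a = begin
    ∣ B j ++ pinned j c ∣      ≡⟨ ∣p++q∣≡∣p∣+∣q∣ (B j) (pinned j c) ⟩
    ∣ B j ∣ + ∣ pinned j c ∣   ≤⟨ +-mono-≤ (width j) (∣pinned∣≤1 j c) ⟩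
    suc k + 1                  ≡⟨ +-comm (suc k) 1 ⟩
    suc (suc k)                ∎
    where
    open ≤-Reasoning
    j = quotient a
    c = proj₂ (remQuot {r} (suc m) a)

data PrimalEdge (m : ℕ) : Fin (m + (m + m)) → Set where
  base   : (e : Fin m) → PrimalEdge m (e ↑ˡ (m + m))
  srcLeg : (e : Fin m) → PrimalEdge m (m ↑ʳ (e ↑ˡ m))
  tgtLeg : (e : Fin m) → PrimalEdge m (m ↑ʳ (m ↑ʳ e))

primalEdge : ∀ m (a : Fin (m + (m + m))) → PrimalEdge m a
primalEdge m a with splitView m (m + m) a
... | left e = base e
... | right b with splitView m m b
...   | left e  = srcLeg e
...   | right e = tgtLeg e

module _ (G : Graph) where
  private
    H = primalH G
    N = n G
    M = m G

  src-base : ∀ e → src H (e ↑ˡ (M + M)) ≡ src G e ↑ˡ M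
  src-base e rewrite splitAt-↑ˡ M e (M + M) = refl

  tgt-base : ∀ e → tgt H (e ↑ˡ (M + M)) ≡ tgt G e ↑ˡ M
  tgt-base e rewrite splitAt-↑ˡ M e (M + M) = refl

  src-srcLeg : ∀ e → src H (M ↑ʳ (e ↑ˡ M)) ≡ src G e ↑ˡ M
  src-srcLeg e rewrite splitAt-↑ʳ M (M + M) (e ↑ˡ M) | splitAt-↑ˡ M e M = refl

  tgt-srcLeg : ∀ e → tgt H (M ↑ʳ (e ↑ˡ M)) ≡ N ↑ʳ e
  tgt-srcLeg e rewrite splitAt-↑ʳ M (M + M) (e ↑ˡ M) | splitAt-↑ˡ M e M = refl

  src-tgtLeg : ∀ e → src H (M ↑ʳ (M ↑ʳ e)) ≡ tgt G e ↑ˡ M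
  src-tgtLeg e rewrite splitAt-↑ʳ M (M + M) (M ↑ʳ e) | splitAt-↑ʳ M M e = refl

  tgt-tgtLeg : ∀ e → tgt H (M ↑ʳ (M ↑ʳ e)) ≡ N ↑ʳ e
  tgt-tgtLeg e rewrite splitAt-↑ʳ M (M + M) (M ↑ʳ e) | splitAt-↑ʳ M M e = refl

module Restriction (G : Graph) where
  private
    H = primalH G
    N = n G
    M = m G

  restrict : Subgraph H → Subgraph G
  restrict S = record
    { vs     = take N (vs S)
    ; es     = take M (es S)
    ; closed = λ e h →
        let src∈ , tgt∈ = closed S (e ↑ˡ (M + M)) (∈-take⁻ (es S) h) in
        ∈-take⁺ (vs S) (subst (_∈ vs S) (src-base G e) src∈) ,
        ∈-take⁺ (vs S) (subst (_∈ vs S) (tgt-base G e) tgt∈)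
    }

  restrict-pw : ∀ {S k} → PW≤ S k → PW≤ (restrict S) k
  restrict-pw {S} P = record
    { r      = r
    ; bag    = take N ∘ bag
    ; bag⊆   = λ j v h → ∈-take⁺ (vs S) (bag⊆ j (v ↑ˡ M) (∈-take⁻ (bag j) h))
    ; vcover = λ v h → let j , h′ = vcover (v ↑ˡ M) (∈-take⁻ (vs S) h) in j , ∈-take⁺ (bag j) h′
    ; ecover = λ e h →
        let j , src∈ , tgt∈ = ecover (e ↑ˡ (M + M)) (∈-take⁻ (es S) h) in
        j , ∈-take⁺ (bag j) (subst (_∈ bag j) (src-base G e) src∈) ,
            ∈-take⁺ (bag j) (subst (_∈ bag j) (tgt-base G e) tgt∈)
    ; contig = take-contiguous bag contig
    ; width  = λ j → ≤-trans (∣take∣≤∣p∣ {N} (bag j)) (width j)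
    }
    where open PathDecomp P

  dpw-primal⇒dpw : ∀ {d k} → DPW≤ d H k → DPW≤ d G k
  dpw-primal⇒dpw (Hs , pws , vcover , ecover) =
    restrict ∘ Hs ,
    restrict-pw ∘ pws ,
    (λ v → let i , h = vcover (v ↑ˡ M) in i , ∈-take⁺ (vs (Hs i)) h) ,
    (λ e → let i , h = ecover (e ↑ˡ (M + M)) in i , ∈-take⁺ (es (Hs i)) h)

module Extension (G : Graph) {d : ℕ} (Gs : Fin d → Subgraph G)
                 (edgeCover : ∀ e → ∃[ i ] (e ∈ es (Gs i))) where
  private
    H = primalH G
    N = n G
    M = m G

  owner : Fin M → Fin d
  owner e = proj₁ (edgeCover e)

  owner-∈es : ∀ {e i} → owner e ≡ i → e ∈ es (Gs i)
  owner-∈es refl = proj₂ (edgeCover _)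

  owned : Fin d → Subset M
  owned i = tabulate λ e → does (owner e Fin.≟ i)

  ∈-owned⁺ : ∀ {e i} → owner e ≡ i → e ∈ owned i
  ∈-owned⁺ {e} {i} p = ∈-tabulate⁺ _ (dec-true (owner e Fin.≟ i) p)

  ∈-owned⁻ : ∀ {e i} → e ∈ owned i → owner e ≡ i
  ∈-owned⁻ {e} {i} h with owner e Fin.≟ i | ∈-tabulate⁻ (λ e → does (owner e Fin.≟ i)) h
  ... | yes p | _  = p
  ... | no _  | ()

  extended : Fin d → Subgraph H
  extended i = record
    { vs     = vs (Gs i) ++ owned i
    ; es     = es (Gs i) ++ (owned i ++ owned i)
    ; closed = λ a → closed′ a (primalEdge M a)
    }
    where
    V = vs (Gs i) ++ owned i
    closed′ : ∀ a → PrimalEdge M a → a ∈ es (Gs i) ++ (owned i ++ owned i) →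
              src H a ∈ V × tgt H a ∈ V
    closed′ .(e ↑ˡ (M + M)) (base e) h =
      let src∈ , tgt∈ = closed (Gs i) e (∈-++⁻ˡ (es (Gs i)) _ h) in
      subst (_∈ V) (sym (src-base G e)) (∈-++⁺ˡ (vs (Gs i)) _ src∈) ,
      subst (_∈ V) (sym (tgt-base G e)) (∈-++⁺ˡ (vs (Gs i)) _ tgt∈)
    closed′ .(M ↑ʳ (e ↑ˡ M)) (srcLeg e) h =
      let e∈ = ∈-++⁻ˡ (owned i) (owned i) (∈-++⁻ʳ (es (Gs i)) _ h) in
      subst (_∈ V) (sym (src-srcLeg G e))
        (∈-++⁺ˡ (vs (Gs i)) _ (proj₁ (closed (Gs i) e (owner-∈es (∈-owned⁻ e∈))))) ,
      subst (_∈ V) (sym (tgt-srcLeg G e)) (∈-++⁺ʳ (vs (Gs i)) _ e∈)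
    closed′ .(M ↑ʳ (M ↑ʳ e)) (tgtLeg e) h =
      let e∈ = ∈-++⁻ʳ (owned i) (owned i) (∈-++⁻ʳ (es (Gs i)) _ h) in
      subst (_∈ V) (sym (src-tgtLeg G e))
        (∈-++⁺ˡ (vs (Gs i)) _ (proj₂ (closed (Gs i) e (owner-∈es (∈-owned⁻ e∈))))) ,
      subst (_∈ V) (sym (tgt-tgtLeg G e)) (∈-++⁺ʳ (vs (Gs i)) _ e∈)

  module _ {k : ℕ} (i : Fin d) (P : PW≤ (Gs i) k) where
    open PathDecomp P

    slot : Fin M → Maybe (Fin r)
    slot e with owner e Fin.≟ i
    ... | yes p = just (proj₁ (ecover e (owner-∈es p)))
    ... | no _  = nothing

    slot-just⁻ : ∀ {e j} → slot e ≡ just j → owner e ≡ i × src G e ∈ bag j × tgt G e ∈ bag j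
    slot-just⁻ {e} s with owner e Fin.≟ i | s
    ... | yes p | refl = p , proj₂ (ecover e (owner-∈es p))
    ... | no _  | ()

    slot-just⁺ : ∀ {e} → owner e ≡ i → ∃[ j ] (slot e ≡ just j)
    slot-just⁺ {e} p with owner e Fin.≟ i
    ... | yes _ = _ , refl
    ... | no ¬p = contradiction p ¬p

    open Refinement bag slot

    private
      S = extended i
      V = vs (Gs i)
      X = owned i

    refined⊆extended : ∀ a w → w ∈ refined a → w ∈ vs S
    refined⊆extended a w = go (splitView N M w)
      where
      go : ∀ {w} → SplitView N M w → w ∈ refined a → w ∈ vs S
      go (left v)  h = ∈-++⁺ˡ V X (bag⊆ (quotient a) v (old∈refined⁻ a h))
      go (right e) h =
        let _ , s , _ = new∈refined⁻ a h in ∈-++⁺ʳ V X (∈-owned⁺ (proj₁ (slot-just⁻ s)))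

    refined-vcover : ∀ w → w ∈ vs S → ∃[ a ] (w ∈ refined a)
    refined-vcover w = go (splitView N M w)
      where
      go : ∀ {w} → SplitView N M w → w ∈ vs S → ∃[ a ] (w ∈ refined a)
      go (left v)  h = let j , h′ = vcover v (∈-++⁻ˡ V X h) in combine j Fin.zero , old∈refined⁺ Fin.zero h′
      go (right e) h =
        let j , s = slot-just⁺ (∈-owned⁻ (∈-++⁻ʳ V X h)) in combine j (Fin.suc e) , new∈refined⁺ s

    refined-ecover : ∀ a → a ∈ es S → ∃[ b ] (src H a ∈ refined b × tgt H a ∈ refined b)
    refined-ecover a = go (primalEdge M a)
      where
      go : ∀ {a} → PrimalEdge M a → a ∈ es S → ∃[ b ] (src H a ∈ refined b × tgt H a ∈ refined b)
      go (base e) h =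
        let j , src∈ , tgt∈ = ecover e (∈-++⁻ˡ (es (Gs i)) _ h)
            b = combine j Fin.zero in
        b , subst (_∈ refined b) (sym (src-base G e)) (old∈refined⁺ Fin.zero src∈) ,
            subst (_∈ refined b) (sym (tgt-base G e)) (old∈refined⁺ Fin.zero tgt∈)
      go (srcLeg e) h =
        let j , s = slot-just⁺ (∈-owned⁻ (∈-++⁻ˡ X X (∈-++⁻ʳ (es (Gs i)) _ h)))
            _ , src∈ , _ = slot-just⁻ s
            b = combine j (Fin.suc e) in
        b , subst (_∈ refined b) (sym (src-srcLeg G e)) (old∈refined⁺ (Fin.suc e) src∈) ,
            subst (_∈ refined b) (sym (tgt-srcLeg G e)) (new∈refined⁺ s)
      go (tgtLeg e) h =
        let j , s = slot-just⁺ (∈-owned⁻ (∈-++⁻ʳ X X (∈-++⁻ʳ (es (Gs i)) _ h)))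
            _ , _ , tgt∈ = slot-just⁻ s
            b = combine j (Fin.suc e) in
        b , subst (_∈ refined b) (sym (src-tgtLeg G e)) (old∈refined⁺ (Fin.suc e) tgt∈) ,
            subst (_∈ refined b) (sym (tgt-tgtLeg G e)) (new∈refined⁺ s)

    extended-pw : PW≤ S (suc k)
    extended-pw = record
      { r      = r * suc M
      ; bag    = refined
      ; bag⊆   = refined⊆extended
      ; vcover = refined-vcover
      ; ecover = refined-ecover
      ; contig = refined-contiguous contig
      ; width  = refined-width width
      }

  extended-covers-vertices : (∀ v → ∃[ i ] (v ∈ vs (Gs i))) → ∀ w → ∃[ i ] (w ∈ vs (extended i))
  extended-covers-vertices vcover w = go (splitView N M w)
    where
    go : ∀ {w} → SplitView N M w → ∃[ i ] (w ∈ vs (extended i))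
    go (left v)  = let i , h = vcover v in i , ∈-++⁺ˡ (vs (Gs i)) _ h
    go (right e) = owner e , ∈-++⁺ʳ (vs (Gs (owner e))) _ (∈-owned⁺ refl)

  extended-covers-edges : ∀ a → ∃[ i ] (a ∈ es (extended i))
  extended-covers-edges a = go (primalEdge M a)
    where
    go : ∀ {a} → PrimalEdge M a → ∃[ i ] (a ∈ es (extended i))
    go (base e)   = let i , h = edgeCover e in i , ∈-++⁺ˡ (es (Gs i)) _ h
    go (srcLeg e) = owner e , ∈-++⁺ʳ (es (Gs (owner e))) _ (∈-++⁺ˡ (owned (owner e)) _ (∈-owned⁺ refl))
    go (tgtLeg e) = owner e , ∈-++⁺ʳ (es (Gs (owner e))) _ (∈-++⁺ʳ (owned (owner e)) _ (∈-owned⁺ refl))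

dpw⇒dpw-primal : ∀ {d k} (G : Graph) → DPW≤ d G k → DPW≤ d (primalH G) (suc k)
dpw⇒dpw-primal G (Gs , pws , vcover , ecover) =
  extended , (λ i → extended-pw i (pws i)) , extended-covers-vertices vcover , extended-covers-edges
  where open Extension G Gs ecover

proposition4 : (d : ℕ) → 1 ≤ d → (G : Graph) → Simple G → NoIsolatedVertices G →
    (wG wH : ℕ) → IsDPW d G wG → IsDPW d (primalH G) wH →
    (wG ≤ wH) × (wH ≤ suc wG)
proposition4 d _ G _ _ wG wH (dpwG , minimalG) (dpwH , minimalH) =
  minimalG wH (Restriction.dpw-primal⇒dpw G dpwH) ,
  minimalH (suc wG) (dpw⇒dpw-primal G dpwG)
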